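{- Let $G$ be a finite graph on $n$ vertices with $\Delta(G)<\frac{1}{9}n-\frac{1}{3}$, and suppose $k=\chi(G)+1$. Let $P\in V(\mathcal{B}_k(G))$ be a reconstruction candidate, let $u,v$ be distinct non-adjacent vertices of $G$, and let $Q_u\in N_u(P)$ and $Q_v\in N_v(P)$. Then $Q_u$ and $Q_v$ have a common neighbour $R$ in $\mathcal{B}_k(G)$ with $R\notin N[P]$.
   Context: $\chi$ is the chromatic number. An independent set partition of $G$ is a partition of $V(G)$ into nonempty independent sets (parts). For such $P$ and $x\in V(G)$, let $P-x$ be the partition of $V(G)\setminus\{x\}$ obtained by deleting $x$ from its part (discarding that part if empty). The Bell colouring graph $\mathcal{B}(G)$ has as vertices the independent set partitions of $G$, with $P\neq Q$ adjacent iff $P-x=Q-x$ for some $x$; $\mathcal{B}_k(G)$ is its induced subgraph on partitions with at most $k$ parts. $N(P)$ is the set of neighbours of $P$ in $\mathcal{B}_k(G)$ and $N[P]=N(P)\cup\{P\}$. For $x\in V(G)$, $N_x(P)$ is the set of $Q\in N(P)$ with $Q-x=P-x$ (those obtained from $P$ by moving $x$). $C_P$ is the number of connected components of the subgraph of $\mathcal{B}_k(G)$ induced on $N(P)$; $P$ is a reconstruction candidate if $C_P\ge C_{P'}$ for all $P'\in V(\mathcal{B}_k(G))$. -}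

module Defs where

open import Data.Nat using (ℕ; zero; suc; _+_; _*_; _≤_; _<_)
open import Data.Bool using (Bool; true; false; _∧_; not)
open import Data.Fin using (Fin; toℕ)
open import Data.List using (List; map; allFin)
open import Data.Bool.ListAction using (any)
open import Data.Nat using (_<ᵇ_)
open import Data.Product using (Σ; ∃; _×_)
open import Relation.Binary.PropositionalEquality using (_≡_; _≢_)
open import Relation.Nullary using (¬_)

countTrue : List Bool → ℕ
countTrue List.[] = 0
countTrue (true List.∷ bs) = suc (countTrue bs)
countTrue (false List.∷ bs) = countTrue bs

record Graph (n : ℕ) : Set where
  field
    adj     : Fin n → Fin n → Bool
    adj-sym : ∀ x y → adj x y ≡ adj y x
    adj-irr : ∀ x → adj x x ≡ false
open Graph public

degree : ∀ {n} → Graph n → Fin n → ℕ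
degree {n} G x = countTrue (map (adj G x) (allFin n))

Colouring : ∀ {n} → Graph n → ℕ → Set
Colouring {n} G m = Σ (Fin n → Fin m) λ c → ∀ x y → adj G x y ≡ true → c x ≢ c y

IsChromaticNumber : ∀ {n} → Graph n → ℕ → Set
IsChromaticNumber G c = Colouring G c × (∀ m → m < c → ¬ Colouring G m)

-- An independent set partition, represented by its "same part" equivalence relation.
record ISPartition {n : ℕ} (G : Graph n) : Set where
  field
    same       : Fin n → Fin n → Bool
    same-refl  : ∀ x → same x x ≡ true
    same-sym   : ∀ x y → same x y ≡ same y x
    same-trans : ∀ x y z → same x y ≡ true → same y z ≡ true → same x z ≡ true
    indep      : ∀ x y → same x y ≡ true → adj G x y ≡ false
open ISPartition public

isLeader : ∀ {n} {G : Graph n} → ISPartition G → Fin n → Bool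
isLeader {n} P x = not (any (λ y → (toℕ y <ᵇ toℕ x) ∧ same P y x) (allFin n))

numParts : ∀ {n} {G : Graph n} → ISPartition G → ℕ
numParts {n} P = countTrue (map (isLeader P) (allFin n))

SameP : ∀ {n} {G : Graph n} → ISPartition G → ISPartition G → Set
SameP {n} P Q = ∀ (y z : Fin n) → same P y z ≡ same Q y z

DelEq : ∀ {n} {G : Graph n} → Fin n → ISPartition G → ISPartition G → Set
DelEq {n} x P Q = ∀ (y z : Fin n) → y ≢ x → z ≢ x → same P y z ≡ same Q y z

Vk : ∀ {n} → Graph n → ℕ → Set
Vk G k = Σ (ISPartition G) λ P → numParts P ≤ k

part : ∀ {n} {G : Graph n} {k} → Vk G k → ISPartition G
part = Data.Product.proj₁

BAdj : ∀ {n} {G : Graph n} {k} → Vk G k → Vk G k → Set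
BAdj {n} P Q = ¬ SameP (part P) (part Q) × ∃ λ (x : Fin n) → DelEq x (part P) (part Q)

InNx : ∀ {n} {G : Graph n} {k} → Fin n → Vk G k → Vk G k → Set
InNx x P Q = ¬ SameP (part P) (part Q) × DelEq x (part P) (part Q)

-- connectivity inside the subgraph of B_k(G) induced on N(P)
data ReachIn {n} {G : Graph n} {k} (P : Vk G k) : Vk G k → Vk G k → Set where
  here : ∀ {A B} → SameP (part A) (part B) → ReachIn P A B
  step : ∀ {A C B} → BAdj A C → BAdj P C → ReachIn P C B → ReachIn P A B

-- the subgraph of B_k(G) induced on N(P) has exactly c connected components:
-- a system of c representatives in N(P), pairwise in different components,
-- such that every vertex of N(P) lies in the component of some representative.
NumComponents : ∀ {n} {G : Graph n} {k} → Vk G k → ℕ → Set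
NumComponents {G = G} {k} P c =
  Σ (Fin c → Vk G k) λ rep →
    (∀ i → BAdj P (rep i)) ×
    (∀ i j → i ≢ j → ¬ ReachIn P (rep i) (rep j)) ×
    (∀ Q → BAdj P Q → ∃ λ i → ReachIn P Q (rep i))

ReconstructionCandidate : ∀ {n} {G : Graph n} {k} → Vk G k → Set
ReconstructionCandidate {G = G} {k} P =
  ∀ (P' : Vk G k) (c c' : ℕ) → NumComponents P c → NumComponents P' c' → c' ≤ c

module Submission where

-- A proper χ-colouring of G can be rebalanced until every colour class has at least four
-- vertices: while some class s has fewer than four, every vertex lies in s, in another class
-- of at most four vertices, or next to s, and counting with χ ≤ Δ + 1 and 9Δ + 4 ≤ n leaves a
-- vertex of a class of size at least five that can be recoloured s.  For the partition P′ into
-- these classes the sets N_x(P′) lie in n distinct components of N(P′), whereas a partition P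
-- with equal or adjacent neighbours Q₁ ∈ N_x(P), Q₂ ∈ N_y(P), x ≢ y, has fewer than n
-- components; so a reconstruction candidate has no such pair.  The common neighbour R performs
-- both moves, R - v = Qu - v and R - u = Qv - u.  It has at most k parts, and each way in which
-- R could fail to lie outside N[P] yields such a forbidden pair among Qu, Qv and R.

open import Defs
import Data.Nat as ℕ
open import Algebra.Definitions.RawMonoid ℕ.+-0-rawMonoid using (sum)
open import Data.Bool using (Bool; true; false; not; _∧_; _∨_; if_then_else_; T)
import Data.Bool as Bool
open import Data.Bool.Properties using (T-≡; T-∧)
import Data.Bool.Properties as BP
open import Data.Empty using (⊥; ⊥-elim)
open import Data.Fin using (Fin; zero; suc; toℕ)
import Data.Fin as Fin
import Data.Fin.Induction as FinInd
import Data.Fin.Properties as FinP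
open import Data.List using (List; []; _∷_; tabulate; length; lookup; map; allFin)
import Data.List.Properties as LP
open import Data.List.Extrema.Nat using (argmax; f[xs]≤f[argmax])
open import Data.List.Membership.Propositional using (_∈_; _∉_)
open import Data.List.Membership.Propositional.Properties using (∈-allFin)
import Data.List.Relation.Unary.All as All
open import Data.List.Relation.Unary.Any using (here; there)
import Data.List.Relation.Unary.Any as Any
open import Data.List.Relation.Unary.Any.Properties using (any⁺; any⁻; lookup-index)
open import Data.Maybe using (Maybe; just; nothing)
import Data.Maybe as Maybe
import Data.Maybe.Properties as Maybe
open import Data.Nat using (ℕ; zero; suc; _+_; _*_; _∸_; _≤_; _<_; _<ᵇ_; z≤n; s≤s)
import Data.Nat.Induction as ℕInd
import Data.Nat.Properties as ℕP
open import Data.Nat.Tactic.RingSolver using (solve-∀)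
open import Data.Product using (Σ; ∃; ∃₂; _×_; _,_; proj₁; proj₂)
import Data.Product as Product
open import Data.Sum using (_⊎_; inj₁; inj₂)
import Data.Vec.Functional as Vector
import Data.Vec.Functional.Properties as VecP
open import Effect.Monad using (RawMonad)
open import Function using (_∘_; id; case_of_; Injective; Equivalence; _⇔_; mk⇔)
open import Induction.WellFounded using (Acc; acc)
open import Relation.Binary.Definitions using (DecidableEquality; tri<; tri≈; tri>)
open import Relation.Binary.PropositionalEquality
  using (_≡_; _≢_; refl; sym; trans; cong; cong₂; subst)
open import Relation.Nullary using (¬_; ¬?; Dec; yes; no; does; contradiction; _×-dec_)
open import Relation.Nullary.Decidable
  using (decidable-stable; dec-true; dec-false; does-⇔; ¬¬-excluded-middle)
open import Relation.Nullary.Negation using (¬¬-Monad)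

does⇒ : ∀ {A : Set} (d : Dec A) → does d ≡ true → A
does⇒ (yes a) _ = a

does≡ : ∀ {A : Set} {b} (d : Dec A) → (A → b ≡ true) → (b ≡ true → A) → does d ≡ b
does≡ (yes a) A⇒b _ = sym (A⇒b a)
does≡ {b = false} (no _) _ _ = refl
does≡ {b = true} (no ¬a) _ b⇒A = ⊥-elim (¬a (b⇒A refl))

contradictionᵇ : ∀ {A : Set} {b} → b ≡ true → b ≡ false → A
contradictionᵇ refl ()

-- Counting and searching in Fin n

count : ∀ {n} → (Fin n → Bool) → ℕ
count f = countTrue (tabulate f)

select : ∀ {n} (f : Fin n → Bool) → Fin (count f) → Fin n
select {suc n} f i with f zero
select {suc n} f zero    | true  = zero
select {suc n} f (suc i) | true  = suc (select (f ∘ suc) i)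
select {suc n} f i       | false = suc (select (f ∘ suc) i)

select-true : ∀ {n} (f : Fin n → Bool) i → f (select f i) ≡ true
select-true {suc n} f i with f zero in eq
select-true {suc n} f zero    | true  = eq
select-true {suc n} f (suc i) | true  = select-true (f ∘ suc) i
select-true {suc n} f i       | false = select-true (f ∘ suc) i

select-injective : ∀ {n} (f : Fin n → Bool) → Injective _≡_ _≡_ (select f)
select-injective {suc n} f {i} {j} e with f zero
select-injective {suc n} f {zero} {zero} e | true = refl
select-injective {suc n} f {suc i} {suc j} e | true =
  cong suc (select-injective (f ∘ suc) (FinP.suc-injective e))
select-injective {suc n} f {i} {j} e | false =
  select-injective (f ∘ suc) (FinP.suc-injective e)

index : ∀ {n} (f : Fin n → Bool) x → f x ≡ true → Σ (Fin (count f)) λ i → select f i ≡ x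
index {suc n} f zero fx with f zero
... | true = zero , refl
index {suc n} f zero () | false
index {suc n} f (suc x) fx with f zero | index (f ∘ suc) x fx
... | true  | i , e = suc i , cong suc e
... | false | i , e = i , cong suc e

count-false : ∀ n → count {n} (λ _ → false) ≡ 0
count-false zero    = refl
count-false (suc n) = count-false n

injectiveOn⇒count≤ : ∀ {n m} (f : Fin n → Bool) (g : ∀ x → f x ≡ true → Fin m) →
  (∀ x y fx fy → g x fx ≡ g y fy → x ≡ y) → count f ≤ m
injectiveOn⇒count≤ f g inj = FinP.injective⇒≤ λ e →
  select-injective f (inj _ _ (select-true f _) (select-true f _) e)

injective⇒≤count : ∀ {n m} (f : Fin n → Bool) (g : Fin m → Fin n) →
  Injective _≡_ _≡_ g → (∀ i → f (g i) ≡ true) → m ≤ count f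
injective⇒≤count f g inj fg = FinP.injective⇒≤ {f = idx} λ {i} {j} e →
  inj (trans (sym (proj₂ (index f (g i) (fg i))))
      (trans (cong (select f) e) (proj₂ (index f (g j) (fg j)))))
  where
  idx : _ → Fin (count f)
  idx i = proj₁ (index f (g i) (fg i))

_⊆ᵇ_ : ∀ {n} → (Fin n → Bool) → (Fin n → Bool) → Set
f ⊆ᵇ g = ∀ x → f x ≡ true → g x ≡ true

⊆⇒count≤ : ∀ {n} {f g : Fin n → Bool} → f ⊆ᵇ g → count f ≤ count g
⊆⇒count≤ {f = f} {g} f⊆g =
  injective⇒≤count g (select f) (select-injective f) (λ i → f⊆g _ (select-true f i))

⊂⇒count< : ∀ {n} {f g : Fin n → Bool} (w : Fin n) → f ⊆ᵇ g →
  f w ≡ false → g w ≡ true → count f < count g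
⊂⇒count< {f = f} {g} w f⊆g fw gw = injective⇒≤count g h h-injective h-in-g
  where
  h : Fin (suc (count f)) → Fin _
  h zero    = w
  h (suc i) = select f i
  w∉f : ∀ i → w ≢ select f i
  w∉f i e = contradictionᵇ (trans (cong f e) (select-true f i)) fw
  h-injective : Injective _≡_ _≡_ h
  h-injective {zero}  {zero}  e = refl
  h-injective {zero}  {suc j} e = ⊥-elim (w∉f j e)
  h-injective {suc i} {zero}  e = ⊥-elim (w∉f i (sym e))
  h-injective {suc i} {suc j} e = cong suc (select-injective f e)
  h-in-g : ∀ i → g (h i) ≡ true
  h-in-g zero    = gw
  h-in-g (suc i) = f⊆g _ (select-true f i)

count-∨ : ∀ {n} (f g : Fin n → Bool) → count (λ x → f x ∨ g x) ≤ count f + count g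
count-∨ {zero}  f g = z≤n
count-∨ {suc n} f g with f zero | g zero | count-∨ (f ∘ suc) (g ∘ suc)
... | true  | true  | ih = s≤s (ℕP.≤-trans ih (ℕP.+-monoʳ-≤ (count (f ∘ suc)) (ℕP.n≤1+n _)))
... | true  | false | ih = s≤s ih
... | false | true  | ih = ℕP.≤-trans (s≤s ih) (ℕP.≤-reflexive (sym (ℕP.+-suc _ _)))
... | false | false | ih = ih

count-singleton : ∀ {n} (w : Fin n) → count (λ y → does (y FinP.≟ w)) ≤ 1
count-singleton w = injectiveOn⇒count≤ _ (λ _ _ → zero)
  λ x y x≡w y≡w _ → trans (does⇒ (x FinP.≟ w) x≡w) (sym (does⇒ (y FinP.≟ w) y≡w))

covered⇒count≤ : ∀ {n k d} (f : Fin n → Bool) (H : Fin k → Fin n → Bool) →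
  (∀ x → f x ≡ true → ∃ λ i → H i x ≡ true) → (∀ i → count (H i) ≤ d) →
  count f ≤ k * d
covered⇒count≤ {k = zero} f H cover H≤ =
  injectiveOn⇒count≤ f (λ x fx → proj₁ (cover x fx))
    λ x _ fx _ _ → ⊥-elim (FinP.¬Fin0 (proj₁ (cover x fx)))
covered⇒count≤ {k = suc k} {d} f H cover H≤ = begin
  count f                         ≤⟨ ⊆⇒count≤ split ⟩
  count (λ x → H zero x ∨ rest x) ≤⟨ count-∨ (H zero) rest ⟩
  count (H zero) + count rest     ≤⟨ ℕP.+-mono-≤ (H≤ zero) rest≤ ⟩
  d + k * d                       ∎
  where
  open ℕP.≤-Reasoning
  rest : Fin _ → Bool
  rest x = not (H zero x) ∧ f x
  split : f ⊆ᵇ (λ x → H zero x ∨ rest x)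
  split x fx with H zero x
  ... | true  = refl
  ... | false = fx
  cover-rest : ∀ x → rest x ≡ true → ∃ λ i → H (suc i) x ≡ true
  cover-rest x rx with H zero x in h0 | f x in fx
  cover-rest x () | true  | _
  cover-rest x () | false | false
  ... | false | true with cover x fx
  ...   | zero  , h = contradictionᵇ h h0
  ...   | suc i , h = i , h
  rest≤ : count rest ≤ k * d
  rest≤ = covered⇒count≤ rest (H ∘ suc) cover-rest (H≤ ∘ suc)

count≤length : ∀ {n} (f : Fin n → Bool) (xs : List (Fin n)) →
  (∀ x → f x ≡ true → x ∈ xs) → count f ≤ length xs
count≤length f xs f⊆xs = injectiveOn⇒count≤ f (λ x fx → Any.index (f⊆xs x fx))
  λ x y fx fy e → trans (lookup-index (f⊆xs x fx))
                        (trans (cong (lookup xs) e) (sym (lookup-index (f⊆xs y fy))))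

∃-outside : ∀ {n} (f : Fin n → Bool) (xs : List (Fin n)) →
  length xs < count f → ∃ λ a → f a ≡ true × a ∉ xs
∃-outside f xs xs<f with FinP.any? (λ a → (f a Bool.≟ true) ×-dec ¬? (Any.any? (a FinP.≟_) xs))
... | yes found = found
... | no none = contradiction (count≤length f xs inside) (ℕP.<⇒≱ xs<f)
  where
  inside : ∀ x → f x ≡ true → x ∈ xs
  inside x fx = decidable-stable (Any.any? (x FinP.≟_) xs) λ x∉xs → none (x , fx , x∉xs)

injective∧missed⇒< : ∀ {m n} (f : Fin m → Fin n) → Injective _≡_ _≡_ f →
  (z : Fin n) → (∀ a → f a ≢ z) → m < n
injective∧missed⇒< {n = suc n} f f-injective z missing =
  s≤s (FinP.injective⇒≤ λ e → f-injective (FinP.punchOut-injective (z≢f _) (z≢f _) e))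
  where
  z≢f : ∀ a → z ≢ f a
  z≢f a = missing a ∘ sym

countTrue-map-allFin : ∀ {n} (h : Fin n → Bool) → countTrue (map h (allFin n)) ≡ count h
countTrue-map-allFin h = cong countTrue (LP.map-tabulate id h)

search : ∀ {n} → (Fin n → Bool) → Maybe (Fin n)
search {zero}  f = nothing
search {suc n} f = if f zero then just zero else Maybe.map suc (search (f ∘ suc))

search-cong : ∀ {n} {f g : Fin n → Bool} → (∀ x → f x ≡ g x) → search f ≡ search g
search-cong {zero}  f≗g = refl
search-cong {suc n} f≗g = cong₂ (λ b r → if b then just zero else r) (f≗g zero)
  (cong (Maybe.map suc) (search-cong (f≗g ∘ suc)))

search-just : ∀ {n} (f : Fin n → Bool) {a} → search f ≡ just a → f a ≡ true
search-just {suc n} f {a} found with f zero in f0 | search (f ∘ suc) in rest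
search-just {suc n} f {zero}  refl | true  | _      = f0
search-just {suc n} f {suc a} refl | false | just a = search-just (f ∘ suc) rest

search-nothing : ∀ {n} (f : Fin n → Bool) → search f ≡ nothing → ∀ a → f a ≡ false
search-nothing {suc n} f none a with f zero in f0 | search (f ∘ suc) in rest
search-nothing {suc n} f refl zero    | false | nothing = f0
search-nothing {suc n} f refl (suc a) | false | nothing = search-nothing (f ∘ suc) rest a

search-some : ∀ {n} (f : Fin n → Bool) {a} → f a ≡ true → ∃ λ b → search f ≡ just b
search-some f {a} fa with search f in found
... | just b  = b , refl
... | nothing = contradictionᵇ fa (search-nothing f found a)

-- Colour classes

inClass : ∀ {n χ} → (Fin n → Fin χ) → Fin χ → Fin n → Bool
inClass c j w = does (c w FinP.≟ j)

classSize : ∀ {n χ} → (Fin n → Fin χ) → Fin χ → ℕ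
classSize c j = count (inClass c j)

count-in-small-classes : ∀ {n χ b} (c : Fin n → Fin (suc χ)) (s : Fin (suc χ)) →
  count (λ w → not (inClass c s w) ∧ (classSize c (c w) ℕ.≤ᵇ b)) ≤ χ * b
count-in-small-classes {n} {χ} {b} c s = covered⇒count≤ _ (small-class ∘ Fin.punchIn s) cover small≤b
  where
  small-class : Fin (suc χ) → Fin n → Bool
  small-class j w = (classSize c j ℕ.≤ᵇ b) ∧ inClass c j w
  small≤b : ∀ i → count (small-class (Fin.punchIn s i)) ≤ b
  small≤b i with classSize c (Fin.punchIn s i) ℕ.≤ᵇ b in small
  ... | true  = ℕP.≤ᵇ⇒≤ _ b (Equivalence.from T-≡ small)
  ... | false = ℕP.≤-trans (ℕP.≤-reflexive (count-false n)) z≤n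
  cover : ∀ w → (not (inClass c s w) ∧ (classSize c (c w) ℕ.≤ᵇ b)) ≡ true →
    ∃ λ i → small-class (Fin.punchIn s i) w ≡ true
  cover w small with c w FinP.≟ s
  ... | no cw≢s = Fin.punchOut (cw≢s ∘ sym) ,
    trans (cong (λ j → small-class j w) (FinP.punchIn-punchOut (cw≢s ∘ sym)))
          (trans (cong ((classSize c (c w) ℕ.≤ᵇ b) ∧_) (dec-true (c w FinP.≟ c w) refl))
                 (cong (_∧ true) small))

sum-mono : ∀ {m} (f g : Fin m → ℕ) → (∀ j → f j ≤ g j) → sum f ≤ sum g
sum-mono {zero}  f g f≤g = z≤n
sum-mono {suc m} f g f≤g = ℕP.+-mono-≤ (f≤g zero) (sum-mono (f ∘ suc) (g ∘ suc) (f≤g ∘ suc))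

sum-< : ∀ {m} (f g : Fin m → ℕ) → (∀ j → f j ≤ g j) → ∀ s → f s < g s → sum f < sum g
sum-< f g f≤g zero    fs<gs = ℕP.+-mono-<-≤ fs<gs (sum-mono (f ∘ suc) (g ∘ suc) (f≤g ∘ suc))
sum-< f g f≤g (suc s) fs<gs = ℕP.+-mono-≤-< (f≤g zero) (sum-< (f ∘ suc) (g ∘ suc) (f≤g ∘ suc) s fs<gs)

deficit : ∀ {n χ} → (Fin n → Fin χ) → ℕ
deficit c = sum λ j → 4 ∸ classSize c j

Balanced : ∀ {n χ} → (Fin n → Fin χ) → Set
Balanced c = ∀ j → 4 ≤ classSize c j

-- Independent set partitions

module _ {n : ℕ} {G : Graph n} where

  same-row : (Q : ISPartition G) {x y : Fin n} → same Q x y ≡ true →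
    ∀ z → same Q x z ≡ same Q y z
  same-row Q {x} {y} xy z with same Q x z in xz | same Q y z in yz
  ... | true  | true  = refl
  ... | false | false = refl
  ... | true  | false = contradictionᵇ (same-trans Q y x z (trans (same-sym Q y x) xy) xz) yz
  ... | false | true  = contradictionᵇ (same-trans Q x y z xy yz) xz

  earlierInPart : ISPartition G → Fin n → Fin n → Bool
  earlierInPart Q x y = (toℕ y <ᵇ toℕ x) ∧ same Q y x

  isLeader⇒minimal : (Q : ISPartition G) {x y : Fin n} → isLeader Q x ≡ true →
    toℕ y < toℕ x → same Q y x ≡ false
  isLeader⇒minimal Q {x} {y} lx y<x with same Q y x in yx
  ... | false = refl
  ... | true  = contradictionᵇ
    (Equivalence.to T-≡ (any⁺ (earlierInPart Q x) (Any.map earlier (∈-allFin y))))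
    (trans (sym (BP.not-involutive _)) (cong not lx))
    where
    earlier : ∀ {z} → y ≡ z → T (earlierInPart Q x z)
    earlier refl = Equivalence.from T-∧ (ℕP.<⇒<ᵇ y<x , Equivalence.from T-≡ yx)

  leader-unique : (Q : ISPartition G) {x y : Fin n} → isLeader Q x ≡ true → isLeader Q y ≡ true →
    same Q x y ≡ true → x ≡ y
  leader-unique Q {x} {y} lx ly xy with ℕP.<-cmp (toℕ x) (toℕ y)
  ... | tri< x<y _ _ = contradictionᵇ xy (isLeader⇒minimal Q ly x<y)
  ... | tri≈ _ x≡y _ = FinP.toℕ-injective x≡y
  ... | tri> _ _ y<x = contradictionᵇ (trans (same-sym Q y x) xy) (isLeader⇒minimal Q lx y<x)

  leader-exists : (Q : ISPartition G) (x : Fin n) →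
    ∃ λ ℓ → isLeader Q ℓ ≡ true × same Q ℓ x ≡ true
  leader-exists Q x = go x (FinInd.<-wellFounded x)
    where
    go : ∀ x → Acc Fin._<_ x → ∃ λ ℓ → isLeader Q ℓ ≡ true × same Q ℓ x ≡ true
    go x (acc rec) with isLeader Q x in lx
    ... | true  = x , lx , same-refl Q x
    ... | false with Any.satisfied (any⁻ (earlierInPart Q x) (allFin n)
                       (Equivalence.from T-≡ (trans (sym (BP.not-involutive _)) (cong not lx))))
    ...   | y , earlier with Equivalence.to T-∧ earlier
    ...     | y<x , yx with go y (rec (ℕP.<ᵇ⇒< (toℕ y) (toℕ x) y<x))
    ...       | ℓ , lℓ , ℓy = ℓ , lℓ , same-trans Q ℓ y x ℓy (Equivalence.to T-≡ yx)

  Refines : ∀ {m} → (Fin n → Fin m) → ISPartition G → Set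
  Refines f Q = ∀ x y → f x ≡ f y → same Q x y ≡ true

  refining⇒numParts≤ : ∀ {m} (Q : ISPartition G) (f : Fin n → Fin m) → Refines f Q → numParts Q ≤ m
  refining⇒numParts≤ {m} Q f f⊑Q = subst (_≤ m) (sym (countTrue-map-allFin (isLeader Q)))
    (injectiveOn⇒count≤ (isLeader Q) (λ x _ → f x) λ x y lx ly e → leader-unique Q lx ly (f⊑Q x y e))

  numParts≤⇒refining : ∀ {m} (Q : ISPartition G) → numParts Q ≤ m →
    Σ (Fin n → Fin m) λ f → Refines f Q
  numParts≤⇒refining {m} Q parts≤m = label , label⊑Q
    where
    leader : Fin n → Fin n
    leader x = proj₁ (leader-exists Q x)
    leader-index : ∀ x → Σ (Fin (count (isLeader Q))) λ i → select (isLeader Q) i ≡ leader x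
    leader-index x = index (isLeader Q) (leader x) (proj₁ (proj₂ (leader-exists Q x)))
    leaders≤m : count (isLeader Q) ≤ m
    leaders≤m = subst (_≤ m) (countTrue-map-allFin (isLeader Q)) parts≤m
    label : Fin n → Fin m
    label x = Fin.inject≤ (proj₁ (leader-index x)) leaders≤m
    label⊑Q : Refines label Q
    label⊑Q x y e = same-trans Q x (leader x) y
      (trans (same-sym Q x (leader x)) (proj₂ (proj₂ (leader-exists Q x))))
      (subst (λ ℓ → same Q ℓ y ≡ true) (sym same-leader) (proj₂ (proj₂ (leader-exists Q y))))
      where
      same-leader : leader x ≡ leader y
      same-leader = trans (sym (proj₂ (leader-index x)))
        (trans (cong (select (isLeader Q)) (FinP.inject≤-injective leaders≤m leaders≤m _ _ e))
               (proj₂ (leader-index y)))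

  fromKey : {A : Set} → DecidableEquality A → (κ : Fin n → A) →
    (∀ x y → adj G x y ≡ true → κ x ≢ κ y) → ISPartition G
  fromKey _≟_ κ proper = record
    { same       = λ x y → does (κ x ≟ κ y)
    ; same-refl  = λ x → dec-true (κ x ≟ κ x) refl
    ; same-sym   = λ x y → does-⇔ (mk⇔ sym sym) (κ x ≟ κ y) (κ y ≟ κ x)
    ; same-trans = λ x y z xy yz →
        dec-true (κ x ≟ κ z) (trans (does⇒ (κ x ≟ κ y) xy) (does⇒ (κ y ≟ κ z) yz))
    ; indep      = indep′
    }
    where
    indep′ : ∀ x y → does (κ x ≟ κ y) ≡ true → adj G x y ≡ false
    indep′ x y xy with adj G x y in a
    ... | true  = ⊥-elim (proper x y a (does⇒ (κ x ≟ κ y) xy))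
    ... | false = refl

  colourClasses : ∀ {m} → Colouring G m → ISPartition G
  colourClasses (c , proper) = fromKey FinP._≟_ c proper

  numParts-colourClasses : ∀ {m} (c : Colouring G m) → numParts (colourClasses c) ≤ m
  numParts-colourClasses (c , proper) = refining⇒numParts≤ (colourClasses (c , proper)) c
    λ x y e → dec-true (c x FinP.≟ c y) e

  SameP-sym : (A B : ISPartition G) → SameP A B → SameP B A
  SameP-sym A B A≈B y z = sym (A≈B y z)

  SameP-trans : (A B C : ISPartition G) → SameP A B → SameP B C → SameP A C
  SameP-trans A B C A≈B B≈C y z = trans (A≈B y z) (B≈C y z)

  SameP? : (A B : ISPartition G) → Dec (SameP A B)
  SameP? A B = FinP.all? λ y → FinP.all? λ z → same A y z Bool.≟ same B y z

  DelEq-sym : ∀ {x} (A B : ISPartition G) → DelEq x A B → DelEq x B A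
  DelEq-sym A B A≡B y z y≢x z≢x = sym (A≡B y z y≢x z≢x)

  DelEq-trans : ∀ {x} (A B C : ISPartition G) → DelEq x A B → DelEq x B C → DelEq x A C
  DelEq-trans A B C A≡B B≡C y z y≢x z≢x = trans (A≡B y z y≢x z≢x) (B≡C y z y≢x z≢x)

  SameP⇒DelEq : ∀ {x} (A B : ISPartition G) → SameP A B → DelEq x A B
  SameP⇒DelEq A B A≈B y z _ _ = A≈B y z

  rows-agree⇒SameP : ∀ {x} (A B : ISPartition G) → DelEq x A B →
    (∀ a → a ≢ x → same A x a ≡ same B x a) → SameP A B
  rows-agree⇒SameP {x} A B A≡B rows y z with y FinP.≟ x | z FinP.≟ x
  ... | no y≢x    | no z≢x    = A≡B y z y≢x z≢x
  ... | yes refl  | yes refl  = trans (same-refl A x) (sym (same-refl B x))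
  ... | yes refl  | no z≢x    = rows z z≢x
  ... | no y≢x    | yes refl  = trans (same-sym A y x) (trans (rows y y≢x) (same-sym B x y))

  moved-vertex-leaves : ∀ {x a} (A B : ISPartition G) → ¬ SameP A B → DelEq x A B → a ≢ x →
    same A x a ≡ true → same B x a ≡ false
  moved-vertex-leaves {x} {a} A B A≢B A≡B a≢x xa with same B x a in xa′
  ... | false = refl
  ... | true  = ⊥-elim (A≢B (rows-agree⇒SameP A B A≡B λ b b≢x →
          trans (same-row A xa b) (trans (A≡B a b a≢x b≢x) (sym (same-row B xa′ b)))))

  -- Give each vertex y the Q-label of y, or of a partner of x in P when y = x: it differs from the
  -- Q-label of x, so punching that label out leaves m labels.
  isolated-move⇒fewer-parts : ∀ {m x} (P Q : ISPartition G) → ¬ SameP P Q → DelEq x P Q →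
    (∀ y → y ≢ x → same Q x y ≡ false) → numParts Q ≤ suc m → numParts P ≤ m
  isolated-move⇒fewer-parts {m} {x} P Q P≉Q P≡Q alone Q≤1+m
    with FinP.any? (λ a → ¬? (a FinP.≟ x) ×-dec (same P x a Bool.≟ true))
  ... | no  no-partner = ⊥-elim (P≉Q (rows-agree⇒SameP P Q P≡Q λ a a≢x →
          trans (BP.¬-not λ xa → no-partner (a , a≢x , xa)) (sym (alone a a≢x))))
  ... | yes (a , a≢x , xa) = refining⇒numParts≤ P label label⊑P
    where
    ℓ : Fin n → Fin (suc m)
    ℓ = proj₁ (numParts≤⇒refining Q Q≤1+m)
    ℓ⊑Q : Refines ℓ Q
    ℓ⊑Q = proj₂ (numParts≤⇒refining Q Q≤1+m)
    stand-in : ∀ y → Σ (Fin n) λ r → r ≢ x × same P y r ≡ true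
    stand-in y with y FinP.≟ x
    ... | yes refl = a , a≢x , xa
    ... | no  y≢x  = y , y≢x , same-refl P y
    r : Fin n → Fin n
    r y = proj₁ (stand-in y)
    ℓx≢ℓr : ∀ y → ℓ x ≢ ℓ (r y)
    ℓx≢ℓr y e = contradictionᵇ (ℓ⊑Q x (r y) e) (alone (r y) (proj₁ (proj₂ (stand-in y))))
    label : Fin n → Fin m
    label y = Fin.punchOut (ℓx≢ℓr y)
    label⊑P : Refines label P
    label⊑P y z e = same-trans P y (r y) z (proj₂ (proj₂ (stand-in y)))
      (same-trans P (r y) (r z) z
        (trans (P≡Q (r y) (r z) (proj₁ (proj₂ (stand-in y))) (proj₁ (proj₂ (stand-in z))))
               (ℓ⊑Q (r y) (r z) (FinP.punchOut-injective (ℓx≢ℓr y) (ℓx≢ℓr z) e)))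
        (trans (same-sym P (r z) z) (proj₂ (proj₂ (stand-in z)))))

  LargeParts : ISPartition G → Set
  LargeParts P = ∀ x y z → ∃ λ a → same P x a ≡ true × a ≢ x × a ≢ y × a ≢ z

  -- Rebalancing a colouring

  degree≡count : ∀ x → degree G x ≡ count (adj G x)
  degree≡count x = countTrue-map-allFin (adj G x)

  free-colour : ∀ {m k} (c : Fin n → Fin k) (ι : Fin m → Fin k) → Injective _≡_ _≡_ ι →
    (x : Fin n) → degree G x < m → ∃ λ j → ∀ y → adj G x y ≡ true → c y ≢ ι j
  free-colour {m} c ι ι-injective x deg<m =
    Product.map₂ (λ unused y xy cy≡ιj → unused (y , xy , cy≡ιj))
      (decidable-stable (FinP.any? (¬? ∘ used?)) all-used⇒⊥)
    where
    used? : ∀ j → Dec (∃ λ y → adj G x y ≡ true × c y ≡ ι j)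
    used? j = FinP.any? λ y → (adj G x y Bool.≟ true) ×-dec (c y FinP.≟ ι j)
    all-used⇒⊥ : ¬ ∃ (λ j → ¬ ∃ λ y → adj G x y ≡ true × c y ≡ ι j) → ⊥
    all-used⇒⊥ none = ℕP.<⇒≱ deg<m (subst (m ≤_) (sym (degree≡count x))
        (injective⇒≤count (adj G x) user user-injective (proj₁ ∘ proj₂ ∘ used)))
      where
      used : ∀ j → ∃ λ y → adj G x y ≡ true × c y ≡ ι j
      used j = decidable-stable (used? j) λ unused → none (j , unused)
      user : Fin m → Fin n
      user j = proj₁ (used j)
      user-injective : Injective _≡_ _≡_ user
      user-injective {i} {j} e = ι-injective (trans (sym (proj₂ (proj₂ (used i))))
                                   (trans (cong c e) (proj₂ (proj₂ (used j)))))

  fewer-colours : ∀ {m} → Colouring G (suc m) → (∀ x → degree G x < m) → Colouring G m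
  fewer-colours {m} (c , proper) small = c′ , proper′
    where
    top : Fin (suc m)
    top = Fin.fromℕ m
    Recolours : Fin n → Fin m → Set
    Recolours x j =
      (c x ≡ top × ∀ y → adj G x y ≡ true → c y ≢ Fin.inject₁ j) ⊎ Fin.inject₁ j ≡ c x
    recolour : ∀ x → Σ (Fin m) (Recolours x)
    recolour x with c x FinP.≟ top
    ... | yes cx≡top = Product.map₂ (λ free → inj₁ (cx≡top , free))
                         (free-colour c Fin.inject₁ FinP.inject₁-injective x (small x))
    ... | no  cx≢top = Fin.lower₁ (c x) m≢cx , inj₂ (FinP.inject₁-lower₁ (c x) m≢cx)
      where
      m≢cx : m ≢ toℕ (c x)
      m≢cx e = cx≢top (FinP.toℕ-injective (trans (sym e) (sym (FinP.toℕ-fromℕ m))))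
    c′ : Fin n → Fin m
    c′ x = proj₁ (recolour x)
    proper′ : ∀ x y → adj G x y ≡ true → c′ x ≢ c′ y
    proper′ x y xy e with proj₂ (recolour x) | proj₂ (recolour y)
    ... | inj₁ (cx≡top , _) | inj₁ (cy≡top , _) = proper x y xy (trans cx≡top (sym cy≡top))
    ... | inj₁ (_ , free)   | inj₂ cy≡        = free y xy (trans (sym cy≡) (cong Fin.inject₁ (sym e)))
    ... | inj₂ cx≡          | inj₁ (_ , free) =
      free x (trans (adj-sym G y x) xy) (trans (sym cx≡) (cong Fin.inject₁ e))
    ... | inj₂ cx≡          | inj₂ cy≡        =
      proper x y xy (trans (sym cx≡) (trans (cong Fin.inject₁ e) cy≡))

  χ≤1+Δ : ∀ {χ D} → IsChromaticNumber G χ → (∀ x → degree G x ≤ D) → χ ≤ suc D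
  χ≤1+Δ {zero}    _ _ = z≤n
  χ≤1+Δ {suc m} {D} (colouring , minimal) deg≤D with m ℕP.≤? D
  ... | yes m≤D = s≤s m≤D
  ... | no  m≰D = ⊥-elim (minimal m (ℕP.n<1+n m)
                    (fewer-colours colouring λ x → ℕP.≤-<-trans (deg≤D x) (ℕP.≰⇒> m≰D)))

  NoNeighbourIn : (Fin n → Bool) → Fin n → Set
  NoNeighbourIn T w = ¬ ∃ λ t → T t ≡ true × adj G t w ≡ true

  touches? : (T : Fin n → Bool) (w : Fin n) → Dec (∃ λ t → T t ≡ true × adj G t w ≡ true)
  touches? T w = FinP.any? λ t → (T t Bool.≟ true) ×-dec (adj G t w Bool.≟ true)

  count-touching≤ : ∀ {D} → (∀ x → degree G x ≤ D) → (T : Fin n → Bool) →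
    count (does ∘ touches? T) ≤ count T * D
  count-touching≤ {D} deg≤D T =
    covered⇒count≤ (does ∘ touches? T) (adj G ∘ select T) cover
      λ i → subst (_≤ D) (degree≡count _) (deg≤D _)
    where
    cover : ∀ w → does (touches? T w) ≡ true → ∃ λ i → adj G (select T i) w ≡ true
    cover w Tw with does⇒ (touches? T w) Tw
    ... | t , Tt , tw with index T t Tt
    ...   | i , refl = i , tw

  movable-vertex : ∀ {χ D} → (∀ x → degree G x ≤ D) → χ ≤ suc D → 7 * D + 4 ≤ n →
    (c : Fin n → Fin χ) (s : Fin χ) → classSize c s < 4 →
    ∃ λ w → 4 < classSize c (c w) × NoNeighbourIn (inClass c s) w
  movable-vertex {suc χ} {D} deg≤D χ≤1+D 7D+4≤n c s small =
    decidable-stable (FinP.any? λ w → (4 ℕP.<? classSize c (c w)) ×-dec ¬? (touches? inS w)) stuck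
    where
    inS inSmallClass nextToS : Fin n → Bool
    inS = inClass c s
    inSmallClass w = not (inS w) ∧ (classSize c (c w) ℕ.≤ᵇ 4)
    nextToS = does ∘ touches? inS
    covered : ¬ (∃ λ w → 4 < classSize c (c w) × NoNeighbourIn inS w) →
      ∀ w → (inS w ∨ (inSmallClass w ∨ nextToS w)) ≡ true
    covered none w with c w FinP.≟ s
    ... | yes _ = refl
    ... | no  _ with classSize c (c w) ℕ.≤ᵇ 4 in small-w
    ...   | true  = refl
    ...   | false with touches? inS w
    ...     | yes _ = refl
    ...     | no  untouched = ⊥-elim (none (w , big , untouched))
      where
      big : 4 < classSize c (c w)
      big = ℕP.≰⇒> λ le → contradictionᵇ (Equivalence.to T-≡ (ℕP.≤⇒≤ᵇ le)) small-w
    stuck : ¬ ¬ ∃ λ w → 4 < classSize c (c w) × NoNeighbourIn inS w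
    stuck none = ℕP.<-irrefl refl (begin-strict
      n
        ≤⟨ injective⇒≤count _ id id (covered none) ⟩
      count (λ w → inS w ∨ (inSmallClass w ∨ nextToS w))
        ≤⟨ count-∨ inS _ ⟩
      count inS + count (λ w → inSmallClass w ∨ nextToS w)
        ≤⟨ ℕP.+-mono-≤ (ℕP.≤-pred small) (count-∨ inSmallClass nextToS) ⟩
      3 + (count inSmallClass + count nextToS)
        ≤⟨ ℕP.+-monoʳ-≤ 3 (ℕP.+-mono-≤ (count-in-small-classes c s) (count-touching≤ deg≤D inS)) ⟩
      3 + (χ * 4 + count inS * D)
        ≤⟨ ℕP.+-monoʳ-≤ 3 (ℕP.+-mono-≤ (ℕP.*-monoˡ-≤ 4 (ℕP.≤-pred χ≤1+D))
                                          (ℕP.*-monoˡ-≤ D (ℕP.≤-pred small))) ⟩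
      3 + (D * 4 + 3 * D)
        ≡⟨ rearrange D ⟩
      7 * D + 3
        <⟨ ℕP.+-monoʳ-< (7 * D) (ℕP.n<1+n 3) ⟩
      7 * D + 4
        ≤⟨ 7D+4≤n ⟩
      n ∎)
      where
      open ℕP.≤-Reasoning
      rearrange : ∀ D → 3 + (D * 4 + 3 * D) ≡ 7 * D + 3
      rearrange = solve-∀

  recolour : ∀ {χ} (c : Colouring G χ) (w : Fin n) (s : Fin χ) →
    NoNeighbourIn (inClass (proj₁ c) s) w → Colouring G χ
  recolour (c , proper) w s untouched = c′ , proper′
    where
    c′ : Fin n → Fin _
    c′ = Vector.updateAt c w (λ _ → s)
    proper′ : ∀ x y → adj G x y ≡ true → c′ x ≢ c′ y
    proper′ x y xy e with x FinP.≟ w | y FinP.≟ w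
    ... | yes refl | yes refl = contradictionᵇ xy (adj-irr G x)
    ... | yes refl | no  y≢w  = untouched (y , dec-true (c y FinP.≟ s) cy≡s , trans (adj-sym G y x) xy)
      where
      cy≡s = trans (sym (VecP.updateAt-minimal y x c y≢w)) (trans (sym e) (VecP.updateAt-updates x c))
    ... | no  x≢w  | yes refl = untouched (x , dec-true (c x FinP.≟ s) cx≡s , xy)
      where
      cx≡s = trans (sym (VecP.updateAt-minimal x y c x≢w)) (trans e (VecP.updateAt-updates y c))
    ... | no  x≢w  | no  y≢w  = proper x y xy
      (trans (sym (VecP.updateAt-minimal x w c x≢w)) (trans e (VecP.updateAt-minimal y w c y≢w)))

  recolour-deficit : ∀ {χ} (c : Colouring G χ) (w : Fin n) (s : Fin χ)
    (untouched : NoNeighbourIn (inClass (proj₁ c) s) w) →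
    classSize (proj₁ c) s < 4 → 4 < classSize (proj₁ c) (proj₁ c w) →
    deficit (proj₁ (recolour c w s untouched)) < deficit (proj₁ c)
  recolour-deficit (c , proper) w s untouched small big =
    sum-< _ _ decreases s (ℕP.≤-<-trans (ℕP.∸-monoʳ-≤ 4 grows-s) (ℕP.∸-monoʳ-< (ℕP.n<1+n _) small))
    where
    c′ : Fin n → Fin _
    c′ = Vector.updateAt c w (λ _ → s)
    s≢cw : s ≢ c w
    s≢cw refl = ℕP.<-asym small big
    grows : ∀ j → j ≢ c w → inClass c j ⊆ᵇ inClass c′ j
    grows j j≢cw y y∈j with y FinP.≟ w
    ... | yes refl = ⊥-elim (j≢cw (sym (does⇒ (c y FinP.≟ j) y∈j)))
    ... | no  y≢w  = trans (cong (λ cy → does (cy FinP.≟ j)) (VecP.updateAt-minimal y w c y≢w)) y∈j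
    grows-s : classSize c s < classSize c′ s
    grows-s = ⊂⇒count< w (grows s s≢cw) (dec-false (c w FinP.≟ s) (s≢cw ∘ sym))
                (dec-true (c′ w FinP.≟ s) (VecP.updateAt-updates w c))
    loses-w : classSize c (c w) ≤ suc (classSize c′ (c w))
    loses-w = begin
      classSize c (c w)                                       ≤⟨ ⊆⇒count≤ moved-or-stayed ⟩
      count (λ y → inClass c′ (c w) y ∨ is-w y)               ≤⟨ count-∨ (inClass c′ (c w)) is-w ⟩
      classSize c′ (c w) + count is-w                         ≤⟨ ℕP.+-monoʳ-≤ _ (count-singleton w) ⟩
      classSize c′ (c w) + 1                                  ≡⟨ ℕP.+-comm _ 1 ⟩
      suc (classSize c′ (c w))                                ∎
      where
      open ℕP.≤-Reasoning
      is-w : Fin n → Bool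
      is-w y = does (y FinP.≟ w)
      moved-or-stayed : inClass c (c w) ⊆ᵇ λ y → inClass c′ (c w) y ∨ is-w y
      moved-or-stayed y y∈cw with y FinP.≟ w
      ... | yes _   = BP.∨-zeroʳ _
      ... | no  y≢w = trans (BP.∨-identityʳ _)
                        (trans (cong (λ cy → does (cy FinP.≟ c w)) (VecP.updateAt-minimal y w c y≢w)) y∈cw)
    decreases : ∀ j → 4 ∸ classSize c′ j ≤ 4 ∸ classSize c j
    decreases j with j FinP.≟ c w
    ... | yes refl =
      ℕP.≤-trans (ℕP.≤-reflexive (ℕP.m≤n⇒m∸n≡0 (ℕP.≤-pred (ℕP.≤-trans big loses-w)))) z≤n
    ... | no  j≢cw = ℕP.∸-monoʳ-≤ 4 (⊆⇒count≤ (grows j j≢cw))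

  balanced-colouring : ∀ {χ D} → (∀ x → degree G x ≤ D) → χ ≤ suc D → 7 * D + 4 ≤ n →
    Colouring G χ → Σ (Colouring G χ) (Balanced ∘ proj₁)
  balanced-colouring {χ} deg≤D χ≤1+D 7D+4≤n c = go c (ℕInd.<-wellFounded (deficit (proj₁ c)))
    where
    go : (c : Colouring G χ) → Acc _<_ (deficit (proj₁ c)) → Σ (Colouring G χ) (Balanced ∘ proj₁)
    go c (acc rec) with FinP.any? (λ j → classSize (proj₁ c) j ℕP.<? 4)
    ... | no  none = c , λ j → ℕP.≮⇒≥ λ small → none (j , small)
    ... | yes (s , small) with movable-vertex deg≤D χ≤1+D 7D+4≤n (proj₁ c) s small
    ...   | w , big , untouched =
            go (recolour c w s untouched) (rec (recolour-deficit c w s untouched small big))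

  balanced⇒large-parts : ∀ {χ} (c : Colouring G χ) → Balanced (proj₁ c) → LargeParts (colourClasses c)
  balanced⇒large-parts (c , _) balanced x y z
    with ∃-outside (inClass c (c x)) (x ∷ y ∷ z ∷ []) (balanced (c x))
  ... | a , a∈cx , a∉xyz = a , dec-true (c x FinP.≟ c a) (sym (does⇒ (c a FinP.≟ c x) a∈cx)) ,
                           a∉xyz ∘ here , a∉xyz ∘ there ∘ here , a∉xyz ∘ there ∘ there ∘ here

  freshColour : ∀ {χ} → Colouring G χ → Fin n → Colouring G (suc χ)
  freshColour {χ} (c , proper) x = c′ , proper′
    where
    c′ : Fin n → Fin (suc χ)
    c′ = Vector.updateAt (Fin.inject₁ ∘ c) x (λ _ → Fin.fromℕ χ)
    proper′ : ∀ y z → adj G y z ≡ true → c′ y ≢ c′ z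
    proper′ y z yz e with y FinP.≟ x | z FinP.≟ x
    ... | yes refl | yes refl = contradictionᵇ yz (adj-irr G y)
    ... | yes refl | no  z≢x  = FinP.fromℕ≢inject₁
      (trans (sym (VecP.updateAt-updates y (Fin.inject₁ ∘ c)))
             (trans e (VecP.updateAt-minimal z y _ z≢x)))
    ... | no  y≢x  | yes refl = FinP.fromℕ≢inject₁
      (trans (sym (VecP.updateAt-updates z (Fin.inject₁ ∘ c)))
             (trans (sym e) (VecP.updateAt-minimal y z _ y≢x)))
    ... | no  y≢x  | no  z≢x  = proper y z yz (FinP.inject₁-injective
      (trans (sym (VecP.updateAt-minimal y x _ y≢x)) (trans e (VecP.updateAt-minimal z x _ z≢x))))

  colourVertex : ∀ {χ} → Colouring G χ → Vk G (suc χ)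
  colourVertex c = colourClasses c , ℕP.m≤n⇒m≤1+n (numParts-colourClasses c)

  freshColour-∈Nx : ∀ {χ} (c : Colouring G χ) {x a} → a ≢ x → same (colourClasses c) x a ≡ true →
    InNx x (colourVertex c) (colourClasses (freshColour c x) , numParts-colourClasses (freshColour c x))
  freshColour-∈Nx {χ} (c , proper) {x} {a} a≢x xa = moved , unchanged
    where
    c′ : Fin n → Fin (suc χ)
    c′ = proj₁ (freshColour (c , proper) x)
    old : ∀ {y} → y ≢ x → c′ y ≡ Fin.inject₁ (c y)
    old {y} y≢x = VecP.updateAt-minimal y x (Fin.inject₁ ∘ c) y≢x
    moved : ¬ SameP (colourClasses (c , proper)) (colourClasses (freshColour (c , proper) x))
    moved same-parts = contradictionᵇ (trans (sym (same-parts x a)) xa)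
      (dec-false (c′ x FinP.≟ c′ a) λ e → FinP.fromℕ≢inject₁
        (trans (sym (VecP.updateAt-updates x (Fin.inject₁ ∘ c))) (trans e (old a≢x))))
    unchanged : DelEq x (colourClasses (c , proper)) (colourClasses (freshColour (c , proper) x))
    unchanged y z y≢x z≢x = trans
      (does-⇔ (mk⇔ (cong Fin.inject₁) FinP.inject₁-injective)
              (c y FinP.≟ c z) (Fin.inject₁ (c y) FinP.≟ Fin.inject₁ (c z)))
      (sym (cong₂ (λ p q → does (p FinP.≟ q)) (old y≢x) (old z≢x)))

  -- Components of the neighbourhood of a partition

  module _ {k : ℕ} where

    Linked : Vk G k → Vk G k → Set
    Linked A B = SameP (part A) (part B) ⊎ BAdj A B

    LinkedNeighbourhoods : Vk G k → Set
    LinkedNeighbourhoods P =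
      ∃₂ λ x y → x ≢ y × ∃₂ λ Q₁ Q₂ → InNx x P Q₁ × InNx y P Q₂ × Linked Q₁ Q₂

    DelEq⇒Linked : ∀ {x} (A B : Vk G k) → DelEq x (part A) (part B) → Linked A B
    DelEq⇒Linked {x} A B A≡B with SameP? (part A) (part B)
    ... | yes A≈B = inj₁ A≈B
    ... | no  A≉B = inj₂ (A≉B , x , A≡B)

    Nx-linked : ∀ {x} (P A B : Vk G k) → InNx x P A → InNx x P B → Linked A B
    Nx-linked P A B (_ , P≡A) (_ , P≡B) =
      DelEq⇒Linked A B (DelEq-trans (part A) (part P) (part B) (DelEq-sym (part P) (part A) P≡A) P≡B)

    BAdj⇒InNx : (P Q : Vk G k) → BAdj P Q → ∃ λ x → InNx x P Q
    BAdj⇒InNx P Q (P≉Q , x , P≡Q) = x , P≉Q , P≡Q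

    BAdj-sym : (A B : Vk G k) → BAdj A B → BAdj B A
    BAdj-sym A B (A≉B , x , A≡B) =
      (λ B≈A → A≉B (SameP-sym (part B) (part A) B≈A)) , x , DelEq-sym (part A) (part B) A≡B

    BAdj-respˡ : (A A′ B : Vk G k) → SameP (part A) (part A′) → BAdj A B → BAdj A′ B
    BAdj-respˡ A A′ B A≈A′ (A≉B , x , A≡B) =
      (λ A′≈B → A≉B (SameP-trans (part A) (part A′) (part B) A≈A′ A′≈B)) , x ,
      DelEq-trans (part A′) (part A) (part B)
        (SameP⇒DelEq (part A′) (part A) (SameP-sym (part A) (part A′) A≈A′)) A≡B

    reach-respˡ : {P A A′ B : Vk G k} → SameP (part A′) (part A) → ReachIn P A B → ReachIn P A′ B
    reach-respˡ {A = A} {A′} {B} A′≈A (here A≈B) =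
      here (SameP-trans (part A′) (part A) (part B) A′≈A A≈B)
    reach-respˡ {A = A} {A′} A′≈A (step {C = C} AC PC r) =
      step (BAdj-respˡ A A′ C (SameP-sym (part A′) (part A) A′≈A) AC) PC r

    reach-trans : {P A B C : Vk G k} → ReachIn P A B → ReachIn P B C → ReachIn P A C
    reach-trans (here A≈B)    r = reach-respˡ A≈B r
    reach-trans (step AC PC r) r′ = step AC PC (reach-trans r r′)

    linked⇒reach : (P A B : Vk G k) → BAdj P B → Linked A B → ReachIn P A B
    linked⇒reach P A B PB (inj₁ A≈B) = here A≈B
    linked⇒reach P A B PB (inj₂ AB)  = step {C = B} AB PB (here (λ _ _ → refl))

    reach-sym : (P A B : Vk G k) → BAdj P A → ReachIn P A B → ReachIn P B A
    reach-sym P A B PA (here A≈B) = here (SameP-sym (part A) (part B) A≈B)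
    reach-sym P A B PA (step {C = C} AC PC r) =
      reach-trans (reach-sym P C B PC r) (linked⇒reach P C A PA (inj₂ (BAdj-sym A C AC)))

    InNx⇒BAdj : ∀ {x} (P Q : Vk G k) → InNx x P Q → BAdj P Q
    InNx⇒BAdj {x} P Q (P≉Q , P≡Q) = P≉Q , x , P≡Q

    -- Sending each representative to a vertex whose move produces it is injective, and misses x
    -- or y because N_x(P) and N_y(P) lie in one component.
    linked-neighbourhoods⇒components<n : ∀ {c} (P : Vk G k) → LinkedNeighbourhoods P →
      NumComponents P c → c < n
    linked-neighbourhoods⇒components<n {c} P (x , y , x≢y , Q₁ , Q₂ , PQ₁ , PQ₂ , Q₁~Q₂)
                                             (rep , rep∈N , apart , cover) =
      injective∧missed⇒< moved moved-injective missed missed-unhit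
      where
      moved : Fin c → Fin n
      moved i = proj₁ (BAdj⇒InNx P (rep i) (rep∈N i))
      rep∈Nmoved : ∀ i → InNx (moved i) P (rep i)
      rep∈Nmoved i = proj₂ (BAdj⇒InNx P (rep i) (rep∈N i))
      component-unique : ∀ {i j} → ReachIn P (rep i) (rep j) → i ≡ j
      component-unique {i} {j} r with i FinP.≟ j
      ... | yes i≡j = i≡j
      ... | no  i≢j = ⊥-elim (apart i j i≢j r)
      reach-rep : ∀ {z} Q i → InNx z P Q → moved i ≡ z → ReachIn P (rep i) Q
      reach-rep Q i PQ refl =
        linked⇒reach P (rep i) Q (InNx⇒BAdj P Q PQ) (Nx-linked P (rep i) Q (rep∈Nmoved i) PQ)
      moved-injective : Injective _≡_ _≡_ moved
      moved-injective {i} {j} e = component-unique (reach-rep (rep j) i (rep∈Nmoved j) e)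
      comp₁ = cover Q₁ (InNx⇒BAdj P Q₁ PQ₁)
      comp₂ = cover Q₂ (InNx⇒BAdj P Q₂ PQ₂)
      i₁ = proj₁ comp₁
      i₁≡i₂ : i₁ ≡ proj₁ comp₂
      i₁≡i₂ = component-unique (reach-trans (reach-sym P Q₁ (rep i₁) (InNx⇒BAdj P Q₁ PQ₁) (proj₂ comp₁))
                (reach-trans (linked⇒reach P Q₁ Q₂ (InNx⇒BAdj P Q₂ PQ₂) Q₁~Q₂) (proj₂ comp₂)))
      moved-x : ∀ a → moved a ≡ x → a ≡ i₁
      moved-x a e = component-unique (reach-trans (reach-rep Q₁ a PQ₁ e) (proj₂ comp₁))
      moved-y : ∀ a → moved a ≡ y → a ≡ i₁
      moved-y a e =
        trans (component-unique (reach-trans (reach-rep Q₂ a PQ₂ e) (proj₂ comp₂))) (sym i₁≡i₂)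
      missed : Fin n
      missed with moved i₁ FinP.≟ x
      ... | yes _ = y
      ... | no  _ = x
      missed-unhit : ∀ a → moved a ≢ missed
      missed-unhit a with moved i₁ FinP.≟ x
      ... | yes i₁↦x = λ a↦y →
        x≢y (trans (sym i₁↦x) (trans (cong moved (sym (moved-y a a↦y))) a↦y))
      ... | no  i₁↛x = λ a↦x → i₁↛x (trans (cong moved (sym (moved-x a a↦x))) a↦x)

    unlinked⇒reach-stays-in-Nx : ∀ {x} (P A B : Vk G k) → ¬ LinkedNeighbourhoods P →
      InNx x P A → ReachIn P A B → InNx x P B
    unlinked⇒reach-stays-in-Nx P A B unlinked (P≉A , P≡A) (here A≈B) =
      (λ P≈B → P≉A (SameP-trans (part P) (part B) (part A) P≈B (SameP-sym (part A) (part B) A≈B))) ,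
      DelEq-trans (part P) (part A) (part B) P≡A (SameP⇒DelEq (part A) (part B) A≈B)
    unlinked⇒reach-stays-in-Nx {x} P A B unlinked PA (step {C = C} AC PC r) with BAdj⇒InNx P C PC
    ... | w , PwC with x FinP.≟ w
    ...   | yes refl = unlinked⇒reach-stays-in-Nx P C B unlinked PwC r
    ...   | no  x≢w  = ⊥-elim (unlinked (x , w , x≢w , A , C , PA , PwC , inj₂ AC))

    unlinked⇒n-components : (P : Vk G k) → ¬ LinkedNeighbourhoods P →
      (∀ x → ∃ λ Q → InNx x P Q) → NumComponents P n
    unlinked⇒n-components P unlinked Nx≠∅ = rep , rep∈N , apart , cover
      where
      rep : Fin n → Vk G k
      rep x = proj₁ (Nx≠∅ x)
      rep∈N : ∀ x → BAdj P (rep x)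
      rep∈N x = InNx⇒BAdj P (rep x) (proj₂ (Nx≠∅ x))
      apart : ∀ x y → x ≢ y → ¬ ReachIn P (rep x) (rep y)
      apart x y x≢y r = unlinked (x , y , x≢y , rep y , rep y ,
        unlinked⇒reach-stays-in-Nx P (rep x) (rep y) unlinked (proj₂ (Nx≠∅ x)) r ,
        proj₂ (Nx≠∅ y) , inj₁ (λ _ _ → refl))
      cover : ∀ Q → BAdj P Q → ∃ λ x → ReachIn P Q (rep x)
      cover Q PQ with BAdj⇒InNx P Q PQ
      ... | x , PxQ = x , linked⇒reach P Q (rep x) (rep∈N x) (Nx-linked P Q (rep x) PxQ (proj₂ (Nx≠∅ x)))

    ComponentsCovering : Vk G k → List (Fin n) → ℕ → Set
    ComponentsCovering P xs c = Σ (Fin c → Vk G k) λ rep →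
      (∀ i → BAdj P (rep i)) × (∀ i j → i ≢ j → ¬ ReachIn P (rep i) (rep j)) ×
      (∀ x → x ∈ xs → ∀ Q → InNx x P Q → ∃ λ i → ReachIn P Q (rep i))

    cover-one-more : ∀ {xs c} (P : Vk G k) (x : Fin n) → ComponentsCovering P xs c →
      ¬ ¬ ∃ λ c′ → ComponentsCovering P (x ∷ xs) c′
    cover-one-more {xs} {c} P x (rep , rep∈N , apart , cover) = do
      yes (Q₀ , PxQ₀) ← ¬¬-excluded-middle {A = ∃ λ Q → InNx x P Q}
        where no Nx=∅ → pure (c , rep , rep∈N , apart , cover-if (λ Q PxQ → ⊥-elim (Nx=∅ (Q , PxQ))))
      let PQ₀ = InNx⇒BAdj P Q₀ PxQ₀
          Nx-reaches-Q₀ : ∀ Q → InNx x P Q → ReachIn P Q Q₀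
          Nx-reaches-Q₀ Q PxQ = linked⇒reach P Q Q₀ PQ₀ (Nx-linked P Q Q₀ PxQ PxQ₀)
      yes (i , Q₀→i) ← ¬¬-excluded-middle {A = ∃ λ i → ReachIn P Q₀ (rep i)}
        where no new → pure (suc c , Q₀ Vector.∷ rep , rep∈N′ PQ₀ , apart′ PQ₀ new , cover′ Nx-reaches-Q₀)
      pure (c , rep , rep∈N , apart , cover-if λ Q PxQ → i , reach-trans (Nx-reaches-Q₀ Q PxQ) Q₀→i)
      where
      open RawMonad ¬¬-Monad
      cover-if : (∀ Q → InNx x P Q → ∃ λ i → ReachIn P Q (rep i)) →
        ∀ x′ → x′ ∈ x ∷ xs → ∀ Q → InNx x′ P Q → ∃ λ i → ReachIn P Q (rep i)
      cover-if Nx-covered x′ (here refl)    = Nx-covered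
      cover-if Nx-covered x′ (there x′∈xs) = cover x′ x′∈xs
      cover′ : ∀ {Q₀} → (∀ Q → InNx x P Q → ReachIn P Q Q₀) →
        ∀ x′ → x′ ∈ x ∷ xs → ∀ Q → InNx x′ P Q → ∃ λ i → ReachIn P Q ((Q₀ Vector.∷ rep) i)
      cover′ Nx→Q₀ x′ (here refl)    Q PxQ  = zero , Nx→Q₀ Q PxQ
      cover′ Nx→Q₀ x′ (there x′∈xs) Q Px′Q = Product.map suc id (cover x′ x′∈xs Q Px′Q)
      rep∈N′ : ∀ {Q₀} → BAdj P Q₀ → ∀ i → BAdj P ((Q₀ Vector.∷ rep) i)
      rep∈N′ PQ₀ zero    = PQ₀
      rep∈N′ PQ₀ (suc i) = rep∈N i
      apart′ : ∀ {Q₀} → BAdj P Q₀ → ¬ (∃ λ i → ReachIn P Q₀ (rep i)) →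
        ∀ i j → i ≢ j → ¬ ReachIn P ((Q₀ Vector.∷ rep) i) ((Q₀ Vector.∷ rep) j)
      apart′ PQ₀ new zero    zero    0≢0 = ⊥-elim (0≢0 refl)
      apart′ PQ₀ new zero    (suc j) _ r = new (j , r)
      apart′ {Q₀} PQ₀ new (suc i) zero    _ r = new (i , reach-sym P (rep i) Q₀ (rep∈N i) r)
      apart′ PQ₀ new (suc i) (suc j) i≢j = apart i j (i≢j ∘ cong suc)

    components-exist : (P : Vk G k) → ¬ ¬ ∃ λ c → NumComponents P c
    components-exist P = do
      c , rep , rep∈N , apart , cover ← covering (allFin n)
      pure (c , rep , rep∈N , apart , λ Q PQ →
        let x , PxQ = BAdj⇒InNx P Q PQ in cover x (∈-allFin x) Q PxQ)
      where
      open RawMonad ¬¬-Monad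
      covering : ∀ xs → ¬ ¬ ∃ λ c → ComponentsCovering P xs c
      covering []       = pure (0 , (λ ()) , (λ ()) , (λ ()) , λ _ ())
      covering (x ∷ xs) = covering xs >>= λ (c , cov) → cover-one-more P x cov

    candidate⇒unlinked : (P : Vk G k) → ReconstructionCandidate P →
      (∃ λ P′ → NumComponents P′ n) → ¬ LinkedNeighbourhoods P
    candidate⇒unlinked P candidate (P′ , P′-comps) linked =
      components-exist P λ (c , P-comps) →
        ℕP.<⇒≱ (linked-neighbourhoods⇒components<n P linked P-comps) (candidate P′ c n P-comps P′-comps)

    large-parts⇒moves-disagree : ∀ {x y z} (P Q₁ Q₂ : Vk G k) → LargeParts (part P) → x ≢ y → x ≢ z →
      InNx x P Q₁ → InNx y P Q₂ → ¬ DelEq z (part Q₁) (part Q₂)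
    large-parts⇒moves-disagree {x} {y} {z} P Q₁ Q₂ large x≢y x≢z (P≉Q₁ , P≡Q₁) (_ , P≡Q₂) Q₁≡Q₂
      with large x y z
    ... | a , xa , a≢x , a≢y , a≢z = contradictionᵇ
      (trans (Q₁≡Q₂ x a x≢z a≢z) (trans (sym (P≡Q₂ x a x≢y a≢y)) xa))
      (moved-vertex-leaves (part P) (part Q₁) P≉Q₁ P≡Q₁ a≢x xa)

    large-parts⇒unlinked : (P : Vk G k) → LargeParts (part P) → ¬ LinkedNeighbourhoods P
    large-parts⇒unlinked P large (x , y , x≢y , Q₁ , Q₂ , PxQ₁ , PyQ₂ , inj₁ Q₁≈Q₂) =
      large-parts⇒moves-disagree P Q₁ Q₂ large x≢y x≢y PxQ₁ PyQ₂
        (SameP⇒DelEq (part Q₁) (part Q₂) Q₁≈Q₂)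
    large-parts⇒unlinked P large (x , y , x≢y , Q₁ , Q₂ , PxQ₁ , PyQ₂ , inj₂ (_ , z , Q₁≡Q₂))
      with x FinP.≟ z
    ... | no  x≢z  = large-parts⇒moves-disagree P Q₁ Q₂ large x≢y x≢z PxQ₁ PyQ₂ Q₁≡Q₂
    ... | yes refl = large-parts⇒moves-disagree P Q₂ Q₁ large (x≢y ∘ sym) (x≢y ∘ sym) PyQ₂ PxQ₁
                       (DelEq-sym (part Q₁) (part Q₂) Q₁≡Q₂)

    unlinked⇒common-neighbour : ∀ {u v} (P Qu Qv R : Vk G k) → ¬ LinkedNeighbourhoods P → u ≢ v →
      InNx u P Qu → InNx v P Qv → DelEq v (part Qu) (part R) → DelEq u (part Qv) (part R) →
      BAdj Qu R × BAdj Qv R × ¬ BAdj P R × ¬ SameP (part P) (part R)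
    unlinked⇒common-neighbour {u} {v} P Qu Qv R unlinked u≢v PuQu PvQv Qu≡R Qv≡R =
      (Qu≉R , v , Qu≡R) , (Qv≉R , u , Qv≡R) , P≁R , P≉R
      where
      Qu≁Qv : ∀ {x} → ¬ DelEq x (part Qu) (part Qv)
      Qu≁Qv Qu≡Qv = unlinked (u , v , u≢v , Qu , Qv , PuQu , PvQv , DelEq⇒Linked Qu Qv Qu≡Qv)
      Qu≉R : ¬ SameP (part Qu) (part R)
      Qu≉R Qu≈R = Qu≁Qv (DelEq-trans (part Qu) (part R) (part Qv)
        (SameP⇒DelEq (part Qu) (part R) Qu≈R) (DelEq-sym (part Qv) (part R) Qv≡R))
      Qv≉R : ¬ SameP (part Qv) (part R)
      Qv≉R Qv≈R = Qu≁Qv (DelEq-trans (part Qu) (part R) (part Qv)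
        Qu≡R (SameP⇒DelEq (part R) (part Qv) (SameP-sym (part Qv) (part R) Qv≈R)))
      P≁R : ¬ BAdj P R
      P≁R PR with BAdj⇒InNx P R PR
      ... | w , PwR with u FinP.≟ w
      ...   | no  u≢w  = unlinked (u , w , u≢w , Qu , R , PuQu , PwR , inj₂ (Qu≉R , v , Qu≡R))
      ...   | yes refl = unlinked (v , u , u≢v ∘ sym , Qv , R , PvQv , PwR , inj₂ (Qv≉R , u , Qv≡R))
      P≉R : ¬ SameP (part P) (part R)
      P≉R P≈R = Qu≁Qv (DelEq-trans (part Qu) (part R) (part Qv) Qu≡R
        (DelEq-trans (part R) (part P) (part Qv)
          (SameP⇒DelEq (part R) (part P) (SameP-sym (part P) (part R) P≈R)) (proj₂ PvQv)))

  balanced⇒n-components : ∀ {χ} (c : Colouring G χ) → Balanced (proj₁ c) →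
    NumComponents (colourVertex c) n
  balanced⇒n-components c balanced =
    unlinked⇒n-components (colourVertex c) (large-parts⇒unlinked (colourVertex c) large) Nx≠∅
    where
    large : LargeParts (colourClasses c)
    large = balanced⇒large-parts c balanced
    Nx≠∅ : ∀ x → ∃ λ Q → InNx x (colourVertex c) Q
    Nx≠∅ x with large x x x
    ... | a , xa , a≢x , _ =
      (colourClasses (freshColour c x) , numParts-colourClasses (freshColour c x)) , freshColour-∈Nx c a≢x xa

  sparse⇒n-components : ∀ {χ} → (∀ x → 9 * degree G x + 3 < n) → IsChromaticNumber G χ → Fin n →
    ∃ λ (P′ : Vk G (suc χ)) → NumComponents P′ n
  sparse⇒n-components {χ} sparse chromatic u =
    let c , balanced = balanced-colouring deg≤Δ (χ≤1+Δ chromatic deg≤Δ) 7Δ+4≤n (proj₁ chromatic)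
    in  colourVertex c , balanced⇒n-components c balanced
    where
    x₀ : Fin n
    x₀ = argmax (degree G) u (allFin n)
    deg≤Δ : ∀ x → degree G x ≤ degree G x₀
    deg≤Δ x = All.lookup (f[xs]≤f[argmax] u (allFin n)) (∈-allFin x)
    7Δ+4≤n : 7 * degree G x₀ + 4 ≤ n
    7Δ+4≤n = ℕP.≤-trans (ℕP.+-monoˡ-≤ 4 (ℕP.*-monoˡ-≤ (degree G x₀) (ℕP.m≤m+n 7 2)))
               (subst (_≤ n) (sym (ℕP.+-suc (9 * degree G x₀) 3)) (sparse x₀))

-- Performing two moves at once

-- The part of y in R is named by key y, the first vertex outside {u, v} that row y puts in the
-- part of y (u follows Qu, v follows Qv, every other vertex follows P); u and v share a part
-- when neither has such a vertex.  Only away and row enter R, so the instance with u and v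
-- exchanged defines the same R.
module JointMove {n : ℕ} {G : Graph n} {m : ℕ} (P Qu Qv : Vk G (suc m)) {u v : Fin n}
  (uv : adj G u v ≡ false) (hu : InNx u P Qu) (hv : InNx v P Qv)
  (away : Fin n → Bool) (away⇔ : ∀ a → away a ≡ true ⇔ (a ≢ u × a ≢ v))
  (row : Fin n → ISPartition G) (row-u : row u ≡ part Qu) (row-v : row v ≡ part Qv)
  (row-away : ∀ a → away a ≡ true → row a ≡ part P)
  where

  p qu qv : ISPartition G
  p  = part P
  qu = part Qu
  qv = part Qv

  position : ∀ y → y ≡ u ⊎ y ≡ v ⊎ away y ≡ true
  position y with y FinP.≟ u | y FinP.≟ v
  ... | yes y≡u | _        = inj₁ y≡u
  ... | no  _   | yes y≡v  = inj₂ (inj₁ y≡v)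
  ... | no  y≢u | no  y≢v  = inj₂ (inj₂ (Equivalence.from (away⇔ y) (y≢u , y≢v)))

  row-agrees : ∀ y {a b} → away a ≡ true → away b ≡ true → same (row y) a b ≡ same p a b
  row-agrees y {a} {b} aa ab with position y | Equivalence.to (away⇔ a) aa | Equivalence.to (away⇔ b) ab
  ... | inj₁ refl        | a≢u , _ | b≢u , _ =
    trans (cong (λ Q → same Q a b) row-u) (sym (proj₂ hu a b a≢u b≢u))
  ... | inj₂ (inj₁ refl) | _ , a≢v | _ , b≢v =
    trans (cong (λ Q → same Q a b) row-v) (sym (proj₂ hv a b a≢v b≢v))
  ... | inj₂ (inj₂ ay)   | _       | _       = cong (λ Q → same Q a b) (row-away y ay)

  inRow : Fin n → Fin n → Bool
  inRow y a = away a ∧ same (row y) y a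

  key : Fin n → Maybe (Fin n)
  key y = search (inRow y)

  inRow-class : ∀ {y a} → inRow y a ≡ true → ∀ b → inRow y b ≡ away b ∧ same p a b
  inRow-class {y} {a} ya b with away b in ab
  ... | false = refl
  ... | true  = trans (same-row (row y) (BP.∧-conicalʳ _ _ ya) b) (row-agrees y (BP.∧-conicalˡ _ _ ya) ab)

  key-cong : ∀ {y z a b} → inRow y a ≡ true → inRow z b ≡ true → same p a b ≡ true → key y ≡ key z
  key-cong ya zb ab = search-cong λ c →
    trans (inRow-class ya c) (trans (cong (away c ∧_) (same-row p ab c)) (sym (inRow-class zb c)))

  inRow-self : ∀ {z} → away z ≡ true → inRow z z ≡ true
  inRow-self {z} az rewrite az | row-away z az = same-refl p z

  key≡⇔ : ∀ {y z} → away z ≡ true → key y ≡ key z ⇔ same (row y) y z ≡ true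
  key≡⇔ {y} {z} az = mk⇔ to (λ yz → key-cong (trans (cong (_∧ _) az) yz) (inRow-self az) (same-refl p z))
    where
    to : key y ≡ key z → same (row y) y z ≡ true
    to ky≡kz with search-some (inRow z) (inRow-self az)
    ... | a , kz≡a = BP.∧-conicalʳ _ _
      (trans (inRow-class ya z) (trans (sym (inRow-class za z)) (inRow-self az)))
      where
      za = search-just (inRow z) kz≡a
      ya = search-just (inRow y) (trans ky≡kz kz≡a)

  proper : ∀ y z → adj G y z ≡ true → key y ≢ key z
  proper y z yz ky≡kz with position y | position z
  ... | _                | inj₂ (inj₂ az) =
    contradictionᵇ yz (indep (row y) y z (Equivalence.to (key≡⇔ az) ky≡kz))
  ... | inj₂ (inj₂ ay)   | _              =
    contradictionᵇ (trans (adj-sym G z y) yz) (indep (row z) z y (Equivalence.to (key≡⇔ ay) (sym ky≡kz)))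
  ... | inj₁ refl        | inj₁ refl        = contradictionᵇ yz (adj-irr G y)
  ... | inj₁ refl        | inj₂ (inj₁ refl) = contradictionᵇ yz uv
  ... | inj₂ (inj₁ refl) | inj₁ refl        = contradictionᵇ yz (trans (adj-sym G v u) uv)
  ... | inj₂ (inj₁ refl) | inj₂ (inj₁ refl) = contradictionᵇ yz (adj-irr G y)

  R : ISPartition G
  R = fromKey (Maybe.≡-dec FinP._≟_) key proper

  sameR≡row : ∀ {y z} → away z ≡ true → same R y z ≡ same (row y) y z
  sameR≡row {y} {z} az = does≡ (Maybe.≡-dec FinP._≟_ (key y) (key z))
    (Equivalence.to (key≡⇔ az)) (Equivalence.from (key≡⇔ az))

  R-agrees : DelEq v qu R
  R-agrees y z y≢v z≢v with position y | position z
  ... | _                | inj₂ (inj₁ z≡v) = ⊥-elim (z≢v z≡v)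
  ... | inj₂ (inj₁ y≡v)  | _               = ⊥-elim (y≢v y≡v)
  ... | inj₁ refl        | inj₁ refl       = trans (same-refl qu y) (sym (same-refl R y))
  ... | inj₁ refl        | inj₂ (inj₂ az)  = sym (trans (sameR≡row az) (cong (λ Q → same Q y z) row-u))
  ... | inj₂ (inj₂ ay)   | inj₁ refl       =
    trans (same-sym qu y z) (sym (trans (same-sym R y z) (trans (sameR≡row ay) (cong (λ Q → same Q z y) row-u))))
  ... | inj₂ (inj₂ ay)   | inj₂ (inj₂ az)  =
    trans (sym (proj₂ hu y z (proj₁ (Equivalence.to (away⇔ y) ay)) (proj₁ (Equivalence.to (away⇔ z) az))))
          (sym (trans (sameR≡row az) (cong (λ Q → same Q y z) (row-away y ay))))

  unkeyed : ∀ {y} → key y ≡ nothing → y ≡ u ⊎ y ≡ v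
  unkeyed {y} ky with position y
  ... | inj₁ y≡u        = inj₁ y≡u
  ... | inj₂ (inj₁ y≡v) = inj₂ y≡v
  ... | inj₂ (inj₂ ay)  with search-some (inRow y) (inRow-self ay)
  ...   | _ , ky≡just = case trans (sym ky) ky≡just of λ ()

  labels⇒numParts≤ : ∀ {k} (ℓ : Fin n → Fin k) → Refines ℓ p → (σ : Fin k) →
    (∀ y z a → key y ≡ nothing → key z ≡ just a → ℓ a ≢ σ) → numParts R ≤ k
  labels⇒numParts≤ ℓ ℓ⊑p σ fresh = refining⇒numParts≤ R label label⊑R
    where
    label : Fin n → Fin _
    label y = Maybe.maybe ℓ σ (key y)
    same-key : ∀ y z → label y ≡ label z → key y ≡ key z
    same-key y z e with key y in ky | key z in kz
    ... | just a  | just b  =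
      trans (sym ky) (trans (key-cong (search-just _ ky) (search-just _ kz) (ℓ⊑p a b e)) kz)
    ... | nothing | nothing = refl
    ... | just a  | nothing = ⊥-elim (fresh z y a kz ky e)
    ... | nothing | just b  = ⊥-elim (fresh y z b ky kz (sym e))
    label⊑R : Refines label R
    label⊑R y z e = dec-true (Maybe.≡-dec FinP._≟_ (key y) (key z)) (same-key y z e)

  keyed⇒numParts≤ : (∃ λ a → key u ≡ just a) → (∃ λ b → key v ≡ just b) → numParts R ≤ suc m
  keyed⇒numParts≤ (_ , ku) (_ , kv) =
    labels⇒numParts≤ (proj₁ P-labels) (proj₂ P-labels) zero λ y _ _ ky _ → case unkeyed ky of λ where
      (inj₁ refl) → case trans (sym ku) ky of λ ()
      (inj₂ refl) → case trans (sym kv) ky of λ ()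
    where
    P-labels = numParts≤⇒refining p (proj₂ P)

  inRow-u : ∀ {a} → away a ≡ true → same qu u a ≡ true → inRow u a ≡ true
  inRow-u aa ua rewrite aa | row-u = ua

  -- Either u is alone in Qu, and then P has at most m parts and the label fromℕ m is free; or u
  -- joined the part of v in Qu, and then no vertex outside {u, v} carries the label of v in P.
  unkeyed-u⇒numParts≤ : key u ≡ nothing → numParts R ≤ suc m
  unkeyed-u⇒numParts≤ ku with FinP.any? (λ y → ¬? (y FinP.≟ u) ×-dec (same qu u y Bool.≟ true))
  ... | no alone = labels⇒numParts≤ (Fin.inject₁ ∘ ℓ) (λ x y e → ℓ⊑p x y (FinP.inject₁-injective e))
                     (Fin.fromℕ m) λ _ _ _ _ _ → FinP.fromℕ≢inject₁ ∘ sym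
    where
    P≤m : numParts p ≤ m
    P≤m = isolated-move⇒fewer-parts p qu (proj₁ hu) (proj₂ hu)
            (λ y y≢u → BP.¬-not λ uy → alone (y , y≢u , uy)) (proj₂ Qu)
    ℓ : Fin n → Fin m
    ℓ = proj₁ (numParts≤⇒refining p P≤m)
    ℓ⊑p : Refines ℓ p
    ℓ⊑p = proj₂ (numParts≤⇒refining p P≤m)
  ... | yes (y , y≢u , uy) with y FinP.≟ v
  ...   | no  y≢v  = contradictionᵇ (inRow-u (Equivalence.from (away⇔ y) (y≢u , y≢v)) uy)
                                    (search-nothing (inRow u) ku y)
  ...   | yes refl = labels⇒numParts≤ ℓ ℓ⊑p (ℓ v) fresh
    where
    ℓ : Fin n → Fin (suc m)
    ℓ = proj₁ (numParts≤⇒refining p (proj₂ P))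
    ℓ⊑p : Refines ℓ p
    ℓ⊑p = proj₂ (numParts≤⇒refining p (proj₂ P))
    fresh : ∀ y z a → key y ≡ nothing → key z ≡ just a → ℓ a ≢ ℓ v
    fresh _ z a _ kz ℓa≡ℓv =
      contradictionᵇ (inRow-u aa (same-trans qu u v a uy va)) (search-nothing (inRow u) ku a)
      where
      aa : away a ≡ true
      aa = BP.∧-conicalˡ _ _ (search-just (inRow z) kz)
      va : same qu v a ≡ true
      va = trans (sym (proj₂ hu v a y≢u (proj₁ (Equivalence.to (away⇔ a) aa))))
                 (trans (same-sym p v a) (ℓ⊑p a v ℓa≡ℓv))

module _ {n : ℕ} {G : Graph n} {m : ℕ} where

  jointMove : (P Qu Qv : Vk G (suc m)) {u v : Fin n} → u ≢ v → adj G u v ≡ false →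
    InNx u P Qu → InNx v P Qv →
    Σ (Vk G (suc m)) λ R → DelEq v (part Qu) (part R) × DelEq u (part Qv) (part R)
  jointMove P Qu Qv {u} {v} u≢v uv hu hv = (UV.R , parts≤) , UV.R-agrees , VU.R-agrees
    where
    away : Fin n → Bool
    away a = not (does (a FinP.≟ u)) ∧ not (does (a FinP.≟ v))
    away⇔ : ∀ a → away a ≡ true ⇔ (a ≢ u × a ≢ v)
    away⇔ a with a FinP.≟ u | a FinP.≟ v
    ... | yes a≡u | _       = mk⇔ (λ ()) λ (a≢u , _) → ⊥-elim (a≢u a≡u)
    ... | no  _   | yes a≡v = mk⇔ (λ ()) λ (_ , a≢v) → ⊥-elim (a≢v a≡v)
    ... | no  a≢u | no  a≢v = mk⇔ (λ _ → a≢u , a≢v) (λ _ → refl)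
    row : Fin n → ISPartition G
    row y = if does (y FinP.≟ u) then part Qu else if does (y FinP.≟ v) then part Qv else part P
    row-u : row u ≡ part Qu
    row-u rewrite dec-true (u FinP.≟ u) refl = refl
    row-v : row v ≡ part Qv
    row-v rewrite dec-false (v FinP.≟ u) (u≢v ∘ sym) | dec-true (v FinP.≟ v) refl = refl
    row-away : ∀ a → away a ≡ true → row a ≡ part P
    row-away a aa rewrite dec-false (a FinP.≟ u) (proj₁ (Equivalence.to (away⇔ a) aa))
                        | dec-false (a FinP.≟ v) (proj₂ (Equivalence.to (away⇔ a) aa)) = refl
    module UV = JointMove P Qu Qv uv hu hv away away⇔ row row-u row-v row-away
    module VU = JointMove P Qv Qu (trans (adj-sym G v u) uv) hv hu away
                  (λ a → mk⇔ (Product.swap ∘ Equivalence.to (away⇔ a))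
                             (Equivalence.from (away⇔ a) ∘ Product.swap))
                  row row-v row-u row-away
    parts≤ : numParts UV.R ≤ suc m
    parts≤ with UV.key u in ku | UV.key v in kv
    ... | nothing | _       = UV.unkeyed-u⇒numParts≤ ku
    ... | just _  | nothing = VU.unkeyed-u⇒numParts≤ kv
    ... | just a  | just b  = UV.keyed⇒numParts≤ (a , ku) (b , kv)

lemma3p5 : ∀ (n : ℕ) (G : Graph n)
    → (∀ (x : Fin n) → 9 * degree G x + 3 < n)
    → ∀ (χ : ℕ) → IsChromaticNumber G χ
    → ∀ (P : Vk G (suc χ)) → ReconstructionCandidate P
    → ∀ (u v : Fin n) → u ≢ v → adj G u v ≡ false
    → ∀ (Qu Qv : Vk G (suc χ)) → InNx u P Qu → InNx v P Qv
    → Σ (Vk G (suc χ)) λ R → BAdj Qu R × BAdj Qv R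
        × ¬ BAdj P R × ¬ SameP (part P) (part R)
lemma3p5 n G sparse χ chromatic P candidate u v u≢v uv Qu Qv PuQu PvQv
  with jointMove P Qu Qv u≢v uv PuQu PvQv
... | R , Qu≡R , Qv≡R = R , unlinked⇒common-neighbour P Qu Qv R unlinked u≢v PuQu PvQv Qu≡R Qv≡R
  where
  unlinked : ¬ LinkedNeighbourhoods P
  unlinked = candidate⇒unlinked P candidate (sparse⇒n-components sparse chromatic u)
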